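{- Let $t\ge 14$, $0<p\le\frac1{t+1}$, and let $\mathcal{A},\mathcal{B}\subset 2^{[n]}$ be shifted, inclusion maximal cross $t$-intersecting families. Let $u=\lambda(\mathcal{A})$ and $v=\lambda(\mathcal{B})$, and suppose $u+v=2t$ and $u\le v$. Put $\widehat{\mathcal{A}}=\mathcal{A}\cap\widehat{\mathcal{F}}^u$, $\widehat{\widehat{\mathcal{A}}}=\mathcal{A}\cap\widehat{\widehat{\mathcal{F}}}^u$, $\widehat{\mathcal{B}}=\mathcal{B}\cap\widehat{\mathcal{F}}^v$, $\widehat{\widehat{\mathcal{B}}}=\mathcal{B}\cap\widehat{\widehat{\mathcal{F}}}^v$, and suppose $\widehat{\mathcal{A}}\neq\emptyset$ and $\widehat{\mathcal{B}}\ne\emptyset$. Then there exist unique nonnegative integers $s$ and $s'$ such that $s-s'=(v-u)/2$, $\widehat{\mathcal{A}}\cup\widehat{\widehat{\mathcal{A}}}\subset\mathcal{F}_s^u$, and $\widehat{\mathcal{B}}\cup\widehat{\widehat{\mathcal{B}}}\subset\mathcal{F}_{s'}^v$.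
   Context: Shifted: whenever $1\le i<j\le n$, $A\in\mathcal{A}$ and $A\cap\{i,j\}=\{j\}$, then $(A\setminus\{j\})\cup\{i\}\in\mathcal{A}$. Inclusion maximal: $A\in\mathcal{A}$, $A\subset A'\subset[n]$ imply $A'\in\mathcal{A}$. Cross $t$-intersecting: $|A\cap B|\ge t$ for all $A\in\mathcal{A},B\in\mathcal{B}$. To $F\subset[n]$ associate the lattice walk from $(0,0)$ whose $i$-th step is up if $i\in F$ and right otherwise; at time $j$ it is at $(j-|F\cap[j]|,|F\cap[j]|)$ ($[0]=\emptyset$), and it hits the line $y=x+c$ iff $2|F\cap[j]|=j+c$ for some $0\le j\le n$. $\lambda(\mathcal{F})$ is the maximum $\lambda$ such that every member's walk hits $y=x+\lambda$. $\mathcal{F}^u$ is the family of $F\subset[n]$ whose walk hits $y=x+u$; $\widehat{\mathcal{F}}^u$ consists of those $F\in\mathcal{F}^u$ whose walk hits $y=x+u$ exactly once and does not hit $y=x+u+1$; $\widehat{\widehat{\mathcal{F}}}^u$ consists of those $F\in\mathcal{F}^u$ whose walk hits $y=x+u$ at least twice and does not hit $y=x+u+1$. For $u+2s\le n$, $\mathcal{F}_s^u=\{F\subset[n]:|F\cap[u+2s]|\geq u+s\}$. -}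

module Defs where

open import Data.Nat using (ℕ; _+_; _*_; _≤_; _<_; _<ᵇ_; _∸_)
open import Data.Fin using (Fin; toℕ)
open import Data.Fin.Subset using (Subset; _∈_; _∉_; _⊆_; _∩_; _∪_; _-_; ⁅_⁆; ∣_∣; inside; outside)
open import Data.Vec using (tabulate)
open import Data.Bool using (if_then_else_)
open import Data.Product using (Σ; ∃; _×_)
open import Relation.Binary.PropositionalEquality using (_≡_)

-- A family of subsets of [n] = {1,…,n}; element k of [n] is represented by Fin n (index k-1).
Family : ℕ → Set₁
Family n = Subset n → Set

-- [j] = {1,…,j} as a subset of [n] (for j ≥ n it is all of [n]); [0] = ∅.
prefix : ∀ {n} → ℕ → Subset n
prefix j = tabulate (λ i → if toℕ i <ᵇ j then inside else outside)

cntPrefix : ∀ {n} → Subset n → ℕ → ℕ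
cntPrefix F j = ∣ F ∩ prefix j ∣

Shifted : ∀ {n} → Family n → Set
Shifted {n} 𝒜 = ∀ (i j : Fin n) (A : Subset n) → i Data.Fin.< j → 𝒜 A → j ∈ A → i ∉ A →
  𝒜 ((A - j) ∪ ⁅ i ⁆)

InclusionMaximal : ∀ {n} → Family n → Set
InclusionMaximal {n} 𝒜 = ∀ (A A' : Subset n) → 𝒜 A → A ⊆ A' → 𝒜 A'

CrossIntersecting : ∀ {n} → ℕ → Family n → Family n → Set
CrossIntersecting t 𝒜 ℬ = ∀ A B → 𝒜 A → ℬ B → t ≤ ∣ A ∩ B ∣

-- The walk of F is on the line y = x + c at time j (0 ≤ j ≤ n): 2|F∩[j]| = j + c
HitsAt : ∀ {n} → Subset n → ℕ → ℕ → Set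
HitsAt {n} F c j = j ≤ n × 2 * cntPrefix F j ≡ j + c

Hits : ∀ {n} → Subset n → ℕ → Set
Hits F c = ∃ λ j → HitsAt F c j

-- λ(𝒜) = u : u is the maximum λ such that every member's walk hits y = x + λ.
-- (λ ranges over ℕ: every walk starts at (0,0) on y = x, so the maximum is ≥ 0.)
IsLambda : ∀ {n} → Family n → ℕ → Set
IsLambda 𝒜 u = (∀ F → 𝒜 F → Hits F u) × (∀ l → (∀ F → 𝒜 F → Hits F l) → l ≤ u)

FU : ∀ {n} → ℕ → Family n
FU u F = Hits F u

FUhat : ∀ {n} → ℕ → Family n
FUhat u F = FU u F × (∃ λ j → HitsAt F u j × (∀ j' → HitsAt F u j' → j' ≡ j))
                    × (Hits F (u + 1) → Data.Empty.⊥)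
  where import Data.Empty

FUhathat : ∀ {n} → ℕ → Family n
FUhathat u F = FU u F × (∃ λ j → ∃ λ j' → j < j' × HitsAt F u j × HitsAt F u j')
                      × (Hits F (u + 1) → Data.Empty.⊥)
  where import Data.Empty

-- 𝓕_s^u = { F ⊆ [n] : |F ∩ [u+2s]| ≥ u+s }, defined when u + 2s ≤ n
-- (membership includes the side condition u + 2s ≤ n).
Fsu : ∀ {n} → ℕ → ℕ → Family n
Fsu {n} s u F = u + 2 * s ≤ n × u + s ≤ cntPrefix F (u + 2 * s)

-- Call (A, B) t-sparse if |A ∩ [j]| + |B ∩ [j]| < j + t for every j ≤ n. If 𝒜 is shifted and all its
-- members t-intersect B, no member of 𝒜 is t-sparse with B: otherwise some element of A ∩ B can be moved
-- down to a position outside A ∪ B, which keeps the pair sparse and lowers |A ∩ B|, until it drops below t.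
-- Let B₀ ∈ ℬ meet y = x + v only at time b. A member of 𝒜 that stays below y = x + u + 1 and is off
-- y = x + u at time b would, since u + v = 2t, be t-sparse with B₀; so every such A is on its line at
-- time b. Symmetrically every such B is on its line at the single hitting time a of A₀, hence a = b.
-- Writing b = u + 2s = v + 2s' gives 𝓕_s^u and 𝓕_{s'}^v, and uniqueness holds because A₀ meets its
-- line only once.
module Submission where

open import Data.Bool using (true; false)
open import Data.Empty using (⊥; ⊥-elim)
open import Data.Fin using (Fin; toℕ) renaming (zero to fzero; suc to fsuc)
open import Data.Fin.Subset using (Subset; _∈_; _∉_; _∩_; _∪_; _-_; ⁅_⁆; ∣_∣) renaming (⊥ to ∅)
open import Data.Fin.Subset.Properties using (∩-comm; ∪-identityʳ)
open import Data.Integer using (+_)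
open import Data.Nat using (ℕ; zero; suc; _+_; _*_; _≤_; _<_; _∸_; _/_; z≤n; s≤s; _≟_; _<?_; _≤?_)
open import Data.Nat.DivMod using (m*n/n≡m)
open import Data.Nat.Properties
open import Data.Nat.Tactic.RingSolver using (solve-∀)
open import Data.Product using (Σ; ∃; _×_; _,_; proj₁; proj₂)
open import Data.Rational using (ℚ; 0ℚ) renaming (_<_ to _<ℚ_; _≤_ to _≤ℚ_; _/_ to _/ℚ_)
open import Data.Sum using (_⊎_; inj₁; inj₂)
open import Data.Vec using (Vec; []; _∷_; zipWith)
open import Data.Vec.Base using (here; there)
open import Data.Vec.Properties using (zipWith-identityʳ)
open import Relation.Binary.PropositionalEquality
open import Relation.Nullary using (¬_; yes; no)

open import Defs

u+2s+u≡2[u+s] : ∀ u s → u + 2 * s + u ≡ 2 * (u + s)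
u+2s+u≡2[u+s] = solve-∀

offset-difference : ∀ {u v s s'} → u ≤ v → u + 2 * s ≡ v + 2 * s' → s ≡ s' + (v ∸ u) / 2
offset-difference {u} {v} {s} {s'} u≤v e = begin
  s                       ≡⟨ m+[n∸m]≡n s'≤s ⟨
  s' + (s ∸ s')           ≡⟨ cong (λ m → s' + m) (m*n/n≡m (s ∸ s') 2) ⟨
  s' + (s ∸ s') * 2 / 2   ≡⟨ cong (λ m → s' + m / 2) (trans (*-comm (s ∸ s') 2) (*-distribˡ-∸ 2 s s')) ⟩
  s' + (2 * s ∸ 2 * s') / 2 ≡⟨ cong (λ m → s' + (m ∸ 2 * s') / 2) 2s≡d+2s' ⟩
  s' + (v ∸ u + 2 * s' ∸ 2 * s') / 2 ≡⟨ cong (λ m → s' + m / 2) (m+n∸n≡m (v ∸ u) (2 * s')) ⟩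
  s' + (v ∸ u) / 2        ∎
  where
  open ≡-Reasoning
  2s≡d+2s' : 2 * s ≡ v ∸ u + 2 * s'
  2s≡d+2s' = +-cancelˡ-≡ u _ _ (trans e (trans (cong (_+ 2 * s') (sym (m+[n∸m]≡n u≤v))) (+-assoc u (v ∸ u) (2 * s'))))
  s'≤s : s' ≤ s
  s'≤s = *-cancelˡ-≤ 2 (subst (2 * s' ≤_) (sym 2s≡d+2s') (m≤n+m (2 * s') (v ∸ u)))

≤-+-≡⇒≡ : ∀ {a b x y} → a ≤ x → b ≤ y → a + b ≡ x + y → a ≡ x
≤-+-≡⇒≡ {a} {_} {x} {y} a≤x b≤y e =
  ≤-antisym a≤x (+-cancelʳ-≤ y x a (subst (_≤ a + y) e (+-monoʳ-≤ a b≤y)))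

halves-sum< : ∀ a b {x y z} → 2 * a ≤ x → 2 * b ≤ y → x + y ≡ 2 * z → (2 * a ≡ x → 2 * b ≡ y → ⊥) → a + b < z
halves-sum< a b {x} {y} {z} 2a≤x 2b≤y x+y≡2z not-both = *-cancelˡ-< 2 (a + b) z (≤∧≢⇒< sum≤ sum≢)
  where
  2[a+b]≡2a+2b : 2 * (a + b) ≡ 2 * a + 2 * b
  2[a+b]≡2a+2b = *-distribˡ-+ 2 a b
  sum≤ : 2 * (a + b) ≤ 2 * z
  sum≤ = subst₂ _≤_ (sym 2[a+b]≡2a+2b) x+y≡2z (+-mono-≤ 2a≤x 2b≤y)
  sum≢ : 2 * (a + b) ≢ 2 * z
  sum≢ e = not-both (≤-+-≡⇒≡ 2a≤x 2b≤y sum≡) (≤-+-≡⇒≡ 2b≤y 2a≤x (trans (+-comm (2 * b) (2 * a)) (trans sum≡ (+-comm x y))))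
    where
    sum≡ : 2 * a + 2 * b ≡ x + y
    sum≡ = trans (sym 2[a+b]≡2a+2b) (trans e (sym x+y≡2z))

cntPrefix-zero : ∀ {n} (F : Subset n) → cntPrefix F 0 ≡ 0
cntPrefix-zero [] = refl
cntPrefix-zero (true ∷ F) = cntPrefix-zero F
cntPrefix-zero (false ∷ F) = cntPrefix-zero F

cntPrefix₂-zero : ∀ {n} (A B : Subset n) → cntPrefix A 0 + cntPrefix B 0 ≡ 0
cntPrefix₂-zero A B = cong₂ _+_ (cntPrefix-zero A) (cntPrefix-zero B)

cntPrefix-∅ : ∀ n j → cntPrefix (∅ {n}) j ≡ 0
cntPrefix-∅ zero j = refl
cntPrefix-∅ (suc n) zero = cntPrefix-zero (∅ {n})
cntPrefix-∅ (suc n) (suc j) = cntPrefix-∅ n j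

cntPrefix≤ : ∀ {n} (F : Subset n) j → cntPrefix F j ≤ j
cntPrefix≤ F zero = ≤-reflexive (cntPrefix-zero F)
cntPrefix≤ [] (suc j) = z≤n
cntPrefix≤ (true ∷ F) (suc j) = s≤s (cntPrefix≤ F j)
cntPrefix≤ (false ∷ F) (suc j) = m≤n⇒m≤1+n (cntPrefix≤ F j)

cntPrefix-suc≤ : ∀ {n} (F : Subset n) j → cntPrefix F (suc j) ≤ suc (cntPrefix F j)
cntPrefix-suc≤ [] j = z≤n
cntPrefix-suc≤ F@(_ ∷ _) zero = ≤-trans (cntPrefix≤ F 1) (s≤s z≤n)
cntPrefix-suc≤ (true ∷ F) (suc j) = s≤s (cntPrefix-suc≤ F j)
cntPrefix-suc≤ (false ∷ F) (suc j) = cntPrefix-suc≤ F j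

cntPrefix-⁅⁆-≤ : ∀ {n} (k : Fin n) j → j ≤ toℕ k → cntPrefix ⁅ k ⁆ j ≡ 0
cntPrefix-⁅⁆-≤ k zero _ = cntPrefix-zero ⁅ k ⁆
cntPrefix-⁅⁆-≤ (fsuc k) (suc j) (s≤s j≤k) = cntPrefix-⁅⁆-≤ k j j≤k

cntPrefix-⁅⁆-> : ∀ {n} (k : Fin n) j → toℕ k < j → cntPrefix ⁅ k ⁆ j ≡ 1
cntPrefix-⁅⁆-> {suc n} fzero (suc j) _ = cong suc (cntPrefix-∅ n j)
cntPrefix-⁅⁆-> (fsuc k) (suc j) (s≤s k<j) = cntPrefix-⁅⁆-> k j k<j

zipWith-cong : ∀ {a} {A : Set a} {n} {f g : A → A → A} → (∀ x y → f x y ≡ g x y) →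
  (xs ys : Vec A n) → zipWith f xs ys ≡ zipWith g xs ys
zipWith-cong f≗g [] [] = refl
zipWith-cong f≗g (x ∷ xs) (y ∷ ys) = cong₂ _∷_ (f≗g x y) (zipWith-cong f≗g xs ys)

-- _─_ is defined through a local helper that Agda parametrises by both arguments, so these
-- equations do not hold by computation alone.
∷-remove-zero : ∀ {n} x (X : Subset n) → (x ∷ X) - fzero ≡ false ∷ X
∷-remove-zero x X = cong (false ∷_) (zipWith-identityʳ (λ _ → refl) X)

∷-remove-suc : ∀ {n} x (X : Subset n) k → (x ∷ X) - fsuc k ≡ x ∷ (X - k)
∷-remove-suc true X k = cong (true ∷_) (zipWith-cong (λ { _ true → refl ; _ false → refl }) X ⁅ k ⁆)
∷-remove-suc false X k = cong (false ∷_) (zipWith-cong (λ { _ true → refl ; _ false → refl }) X ⁅ k ⁆)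

cntPrefix-remove : ∀ {n} (X : Subset n) k → k ∈ X → ∀ j →
  cntPrefix (X - k) j + cntPrefix ⁅ k ⁆ j ≡ cntPrefix X j
cntPrefix-remove X k _ zero
  rewrite cntPrefix-zero (X - k) | cntPrefix-zero ⁅ k ⁆ | cntPrefix-zero X = refl
cntPrefix-remove {suc n} (true ∷ X) fzero here (suc j) =
  trans (cong₂ (λ Y m → cntPrefix Y (suc j) + suc m) (∷-remove-zero true X) (cntPrefix-∅ n j))
        (+-comm (cntPrefix X j) 1)
cntPrefix-remove (true ∷ X) (fsuc k) (there k∈X) (suc j)
  rewrite ∷-remove-suc true X k = cong suc (cntPrefix-remove X k k∈X j)
cntPrefix-remove (false ∷ X) (fsuc k) (there k∈X) (suc j)
  rewrite ∷-remove-suc false X k = cntPrefix-remove X k k∈X j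

cntPrefix-move : ∀ {n} (X : Subset n) i k → toℕ i < toℕ k → k ∈ X → i ∉ X → ∀ j →
  cntPrefix ((X - k) ∪ ⁅ i ⁆) j + cntPrefix ⁅ k ⁆ j ≡ cntPrefix X j + cntPrefix ⁅ i ⁆ j
cntPrefix-move X i k _ _ _ zero
  rewrite cntPrefix-zero ((X - k) ∪ ⁅ i ⁆) | cntPrefix-zero ⁅ k ⁆ | cntPrefix-zero X | cntPrefix-zero ⁅ i ⁆ = refl
cntPrefix-move (true ∷ X) fzero k _ _ i∉X (suc j) = ⊥-elim (i∉X here)
cntPrefix-move {suc n} (false ∷ X) fzero (fsuc k) _ (there k∈X) _ (suc j)
  = begin
    cntPrefix (((false ∷ X) - fsuc k) ∪ ⁅ fzero ⁆) (suc j) + cntPrefix ⁅ k ⁆ j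
      ≡⟨ cong (λ Y → cntPrefix (Y ∪ ⁅ fzero ⁆) (suc j) + cntPrefix ⁅ k ⁆ j) (∷-remove-suc false X k) ⟩
    suc (cntPrefix ((X - k) ∪ ∅) j + cntPrefix ⁅ k ⁆ j)
      ≡⟨ cong (λ Y → suc (cntPrefix Y j + cntPrefix ⁅ k ⁆ j)) (∪-identityʳ (X - k)) ⟩
    suc (cntPrefix (X - k) j + cntPrefix ⁅ k ⁆ j)
      ≡⟨ cong suc (cntPrefix-remove X k k∈X j) ⟩
    suc (cntPrefix X j)
      ≡⟨ +-comm 1 (cntPrefix X j) ⟩
    cntPrefix X j + 1
      ≡⟨ cong (λ m → cntPrefix X j + suc m) (cntPrefix-∅ n j) ⟨
    cntPrefix X j + suc (cntPrefix (∅ {n}) j) ∎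
    where open ≡-Reasoning
cntPrefix-move (true ∷ X) (fsuc i) (fsuc k) (s≤s i<k) (there k∈X) i∉X (suc j)
  rewrite ∷-remove-suc true X k = cong suc (cntPrefix-move X i k i<k k∈X (λ i∈X → i∉X (there i∈X)) j)
cntPrefix-move (false ∷ X) (fsuc i) (fsuc k) (s≤s i<k) (there k∈X) i∉X (suc j)
  rewrite ∷-remove-suc false X k = cntPrefix-move X i k i<k k∈X (λ i∈X → i∉X (there i∈X)) j

∣remove∩∣ : ∀ {n} (X B : Subset n) k → k ∈ X → k ∈ B → suc ∣ (X - k) ∩ B ∣ ≡ ∣ X ∩ B ∣
∣remove∩∣ (true ∷ X) (true ∷ B) fzero here here = cong (λ Y → suc ∣ Y ∩ (true ∷ B) ∣) (∷-remove-zero true X)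
∣remove∩∣ (true ∷ X) (true ∷ B) (fsuc k) (there k∈X) (there k∈B)
  rewrite ∷-remove-suc true X k = cong suc (∣remove∩∣ X B k k∈X k∈B)
∣remove∩∣ (true ∷ X) (false ∷ B) (fsuc k) (there k∈X) (there k∈B)
  rewrite ∷-remove-suc true X k = ∣remove∩∣ X B k k∈X k∈B
∣remove∩∣ (false ∷ X) (y ∷ B) (fsuc k) (there k∈X) (there k∈B)
  rewrite ∷-remove-suc false X k = ∣remove∩∣ X B k k∈X k∈B

∣move∩∣ : ∀ {n} (X B : Subset n) i k → toℕ i < toℕ k → k ∈ X → k ∈ B → i ∉ X → i ∉ B →
  suc ∣ ((X - k) ∪ ⁅ i ⁆) ∩ B ∣ ≡ ∣ X ∩ B ∣
∣move∩∣ (true ∷ X) B fzero k _ _ _ i∉X _ = ⊥-elim (i∉X here)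
∣move∩∣ (false ∷ X) (true ∷ B) fzero k _ _ _ _ i∉B = ⊥-elim (i∉B here)
∣move∩∣ (false ∷ X) (false ∷ B) fzero (fsuc k) _ (there k∈X) (there k∈B) _ _ = begin
  suc ∣ (((false ∷ X) - fsuc k) ∪ ⁅ fzero ⁆) ∩ (false ∷ B) ∣
    ≡⟨ cong (λ Y → suc ∣ (Y ∪ ⁅ fzero ⁆) ∩ (false ∷ B) ∣) (∷-remove-suc false X k) ⟩
  suc ∣ ((X - k) ∪ ∅) ∩ B ∣
    ≡⟨ cong (λ Y → suc ∣ Y ∩ B ∣) (∪-identityʳ (X - k)) ⟩
  suc ∣ (X - k) ∩ B ∣
    ≡⟨ ∣remove∩∣ X B k k∈X k∈B ⟩
  ∣ X ∩ B ∣ ∎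
  where open ≡-Reasoning
∣move∩∣ (true ∷ X) (true ∷ B) (fsuc i) (fsuc k) (s≤s i<k) (there k∈X) (there k∈B) i∉X i∉B
  rewrite ∷-remove-suc true X k =
    cong suc (∣move∩∣ X B i k i<k k∈X k∈B (λ i∈X → i∉X (there i∈X)) (λ i∈B → i∉B (there i∈B)))
∣move∩∣ (true ∷ X) (false ∷ B) (fsuc i) (fsuc k) (s≤s i<k) (there k∈X) (there k∈B) i∉X i∉B
  rewrite ∷-remove-suc true X k =
    ∣move∩∣ X B i k i<k k∈X k∈B (λ i∈X → i∉X (there i∈X)) (λ i∈B → i∉B (there i∈B))
∣move∩∣ (false ∷ X) (y ∷ B) (fsuc i) (fsuc k) (s≤s i<k) (there k∈X) (there k∈B) i∉X i∉B
  rewrite ∷-remove-suc false X k =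
    ∣move∩∣ X B i k i<k k∈X k∈B (λ i∈X → i∉X (there i∈X)) (λ i∈B → i∉B (there i∈B))

cntPrefix-move-outside : ∀ {n} (X : Subset n) i k → toℕ i < toℕ k → k ∈ X → i ∉ X → ∀ j →
  j ≤ toℕ i ⊎ toℕ k < j → cntPrefix ((X - k) ∪ ⁅ i ⁆) j ≡ cntPrefix X j
cntPrefix-move-outside X i k i<k k∈X i∉X j j-outside =
  +-cancelʳ-≡ _ _ _ (trans (cntPrefix-move X i k i<k k∈X i∉X j)
                           (cong (λ m → cntPrefix X j + m) (indicators-agree j-outside)))
  where
  indicators-agree : j ≤ toℕ i ⊎ toℕ k < j → cntPrefix ⁅ i ⁆ j ≡ cntPrefix ⁅ k ⁆ j
  indicators-agree (inj₁ j≤i) = trans (cntPrefix-⁅⁆-≤ i j j≤i) (sym (cntPrefix-⁅⁆-≤ k j (≤-trans j≤i (<⇒≤ i<k))))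
  indicators-agree (inj₂ k<j) = trans (cntPrefix-⁅⁆-> i j (<-trans i<k k<j)) (sym (cntPrefix-⁅⁆-> k j k<j))

cntPrefix-move-inside : ∀ {n} (X : Subset n) i k → toℕ i < toℕ k → k ∈ X → i ∉ X → ∀ j →
  toℕ i < j → j ≤ toℕ k → cntPrefix ((X - k) ∪ ⁅ i ⁆) j ≡ suc (cntPrefix X j)
cntPrefix-move-inside X i k i<k k∈X i∉X j i<j j≤k = begin
  cntPrefix ((X - k) ∪ ⁅ i ⁆) j                         ≡⟨ +-identityʳ _ ⟨
  cntPrefix ((X - k) ∪ ⁅ i ⁆) j + 0                     ≡⟨ cong (λ m → cntPrefix ((X - k) ∪ ⁅ i ⁆) j + m) (cntPrefix-⁅⁆-≤ k j j≤k) ⟨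
  cntPrefix ((X - k) ∪ ⁅ i ⁆) j + cntPrefix ⁅ k ⁆ j     ≡⟨ cntPrefix-move X i k i<k k∈X i∉X j ⟩
  cntPrefix X j + cntPrefix ⁅ i ⁆ j                     ≡⟨ cong (λ m → cntPrefix X j + m) (cntPrefix-⁅⁆-> i j i<j) ⟩
  cntPrefix X j + 1                                     ≡⟨ +-comm (cntPrefix X j) 1 ⟩
  suc (cntPrefix X j)                                   ∎
  where open ≡-Reasoning

Sparse : ∀ {n} → ℕ → Subset n → Subset n → Set
Sparse {n} t A B = ∀ j → j ≤ n → cntPrefix A j + cntPrefix B j < j + t

Sparse⇒0<t : ∀ {n t} (A B : Subset n) → Sparse t A B → 0 < t
Sparse⇒0<t {t = t} A B sparse = subst (_< t) (cntPrefix₂-zero A B) (sparse 0 z≤n)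

-- Moving an element of A ∩ B from k down to i ∉ A ∪ B keeps (A, B) sparse thanks to the slack on (i, k].
record ShiftPair {n} (t : ℕ) (A B : Subset n) : Set where
  constructor shiftPair
  field
    i k : Fin n
    i<k : toℕ i < toℕ k
    k∈A : k ∈ A
    k∈B : k ∈ B
    i∉A : i ∉ A
    i∉B : i ∉ B
    slack : ∀ j → toℕ i < j → j ≤ toℕ k → 2 + cntPrefix A j + cntPrefix B j ≤ j + t

  shifted : Subset n
  shifted = (A - k) ∪ ⁅ i ⁆

ShiftPair-∷ : ∀ {n t t' x y} {A B : Subset n} → ShiftPair t A B →
  (∀ j → 2 + cntPrefix A j + cntPrefix B j ≤ j + t →
         2 + cntPrefix (x ∷ A) (suc j) + cntPrefix (y ∷ B) (suc j) ≤ suc j + t') →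
  ShiftPair t' (x ∷ A) (y ∷ B)
ShiftPair-∷ (shiftPair i k i<k k∈A k∈B i∉A i∉B slack) step =
  shiftPair (fsuc i) (fsuc k) (s≤s i<k) (there k∈A) (there k∈B)
    (λ { (there i∈A) → i∉A i∈A }) (λ { (there i∈B) → i∉B i∈B })
    (λ { (suc j) (s≤s i<j) (s≤s j≤k) → step j (slack j i<j j≤k) })

first-common : ∀ {n} (A B : Subset n) → 0 < ∣ A ∩ B ∣ →
  Σ (Fin n) λ k → k ∈ A × k ∈ B × (∀ j → j ≤ toℕ k → cntPrefix A j + cntPrefix B j ≤ j)
first-common [] [] ()
first-common (true ∷ A) (true ∷ B) _ =
  fzero , here , here , λ { zero _ → ≤-reflexive (cntPrefix₂-zero A B) }
first-common (true ∷ A) (false ∷ B) 0<∣A∩B∣ with first-common A B 0<∣A∩B∣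
... | k , k∈A , k∈B , disjoint-before =
  fsuc k , there k∈A , there k∈B ,
  λ { zero _ → ≤-reflexive (cntPrefix₂-zero A B)
    ; (suc j) (s≤s j≤k) → s≤s (disjoint-before j j≤k) }
first-common (false ∷ A) (true ∷ B) 0<∣A∩B∣ with first-common A B 0<∣A∩B∣
... | k , k∈A , k∈B , disjoint-before =
  fsuc k , there k∈A , there k∈B ,
  λ { zero _ → ≤-reflexive (cntPrefix₂-zero A B)
    ; (suc j) (s≤s j≤k) → subst (_≤ suc j) (sym (+-suc _ _)) (s≤s (disjoint-before j j≤k)) }
first-common (false ∷ A) (false ∷ B) 0<∣A∩B∣ with first-common A B 0<∣A∩B∣
... | k , k∈A , k∈B , disjoint-before =
  fsuc k , there k∈A , there k∈B ,
  λ { zero _ → ≤-reflexive (cntPrefix₂-zero A B)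
    ; (suc j) (s≤s j≤k) → m≤n⇒m≤1+n (disjoint-before j j≤k) }

Sparse⇒ShiftPair : ∀ {n} t (A B : Subset n) → Sparse t A B → t ≤ ∣ A ∩ B ∣ → ShiftPair t A B
Sparse⇒ShiftPair t [] [] sparse t≤0 = ⊥-elim (<⇒≱ (Sparse⇒0<t [] [] sparse) t≤0)
Sparse⇒ShiftPair zero (true ∷ A) (true ∷ B) sparse _ =
  ⊥-elim (<-irrefl refl (Sparse⇒0<t (true ∷ A) (true ∷ B) sparse))
Sparse⇒ShiftPair (suc t) (true ∷ A) (true ∷ B) sparse (s≤s t≤∣A∩B∣) =
  ShiftPair-∷ (Sparse⇒ShiftPair t A B tail-sparse t≤∣A∩B∣) step
  where
  tail-sparse : Sparse t A B
  tail-sparse j j≤n with sparse (suc j) (s≤s j≤n)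
  ... | h rewrite +-suc (cntPrefix A j) (cntPrefix B j) | +-suc j t = ≤-pred (≤-pred h)
  step : ∀ j → 2 + cntPrefix A j + cntPrefix B j ≤ j + t →
    2 + suc (cntPrefix A j) + suc (cntPrefix B j) ≤ suc j + suc t
  step j h rewrite +-suc (cntPrefix A j) (cntPrefix B j) | +-suc j t = s≤s (s≤s h)
Sparse⇒ShiftPair t (true ∷ A) (false ∷ B) sparse t≤∣A∩B∣ =
  ShiftPair-∷ (Sparse⇒ShiftPair t A B (λ j j≤n → ≤-pred (sparse (suc j) (s≤s j≤n))) t≤∣A∩B∣) (λ _ → s≤s)
Sparse⇒ShiftPair t (false ∷ A) (true ∷ B) sparse t≤∣A∩B∣ =
  ShiftPair-∷ (Sparse⇒ShiftPair t A B tail-sparse t≤∣A∩B∣) step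
  where
  tail-sparse : Sparse t A B
  tail-sparse j j≤n with sparse (suc j) (s≤s j≤n)
  ... | h rewrite +-suc (cntPrefix A j) (cntPrefix B j) = ≤-pred h
  step : ∀ j → 2 + cntPrefix A j + cntPrefix B j ≤ j + t →
    2 + cntPrefix A j + suc (cntPrefix B j) ≤ suc j + t
  step j h rewrite +-suc (2 + cntPrefix A j) (cntPrefix B j) = s≤s h
Sparse⇒ShiftPair t (false ∷ A) (false ∷ B) sparse t≤∣A∩B∣ = shift-into-head (first-common A B (≤-trans 0<t t≤∣A∩B∣))
  where
  0<t : 0 < t
  0<t = Sparse⇒0<t (false ∷ A) (false ∷ B) sparse
  shift-into-head : Σ (Fin _) (λ k → k ∈ A × k ∈ B × (∀ j → j ≤ toℕ k → cntPrefix A j + cntPrefix B j ≤ j)) →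
    ShiftPair t (false ∷ A) (false ∷ B)
  shift-into-head (k , k∈A , k∈B , disjoint-below) =
    shiftPair fzero (fsuc k) (s≤s z≤n) (there k∈A) (there k∈B) (λ ()) (λ ())
      λ { (suc j) _ (s≤s j≤k) → s≤s (subst (_≤ j + t) (+-comm _ 1) (+-mono-≤ (disjoint-below j j≤k) 0<t)) }

module _ {n t} {A B : Subset n} (p : ShiftPair t A B) where
  open ShiftPair p

  shifted-Sparse : Sparse t A B → Sparse t shifted B
  shifted-Sparse sparse j j≤n with toℕ i <? j | j ≤? toℕ k
  ... | yes i<j | yes j≤k =
    subst (λ c → c + cntPrefix B j < j + t) (sym (cntPrefix-move-inside A i k i<k k∈A i∉A j i<j j≤k)) (slack j i<j j≤k)
  ... | no i≮j | _ =
    subst (λ c → c + cntPrefix B j < j + t) (sym (cntPrefix-move-outside A i k i<k k∈A i∉A j (inj₁ (≮⇒≥ i≮j)))) (sparse j j≤n)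
  ... | yes _ | no j≰k =
    subst (λ c → c + cntPrefix B j < j + t) (sym (cntPrefix-move-outside A i k i<k k∈A i∉A j (inj₂ (≰⇒> j≰k)))) (sparse j j≤n)

  ∣shifted∩∣ : suc ∣ shifted ∩ B ∣ ≡ ∣ A ∩ B ∣
  ∣shifted∩∣ = ∣move∩∣ A B i k i<k k∈A k∈B i∉A i∉B

  shifted-∈ : ∀ {𝒜 : Family n} → Shifted 𝒜 → 𝒜 A → 𝒜 shifted
  shifted-∈ sh A∈𝒜 = sh i k A i<k A∈𝒜 k∈A i∉A

Shifted⇒¬Sparse : ∀ {n t} {𝒜 : Family n} {B : Subset n} → Shifted 𝒜 → (∀ A → 𝒜 A → t ≤ ∣ A ∩ B ∣) →
  ∀ {A} → 𝒜 A → ¬ Sparse t A B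
Shifted⇒¬Sparse {t = t} {𝒜} {B} sh cross A∈𝒜 sparse = descend _ A∈𝒜 sparse refl
  where
  descend : ∀ m {A} → 𝒜 A → Sparse t A B → ∣ A ∩ B ∣ ≡ m → ⊥
  descend m {A} A∈𝒜 sparse ∣A∩B∣≡m = continue m (trans (∣shifted∩∣ p) ∣A∩B∣≡m)
    where
    p : ShiftPair t A B
    p = Sparse⇒ShiftPair t A B sparse (cross A A∈𝒜)
    continue : ∀ m → suc ∣ ShiftPair.shifted p ∩ B ∣ ≡ m → ⊥
    continue zero ()
    continue (suc m') eq = descend m' (shifted-∈ p sh A∈𝒜) (shifted-Sparse p sparse) (suc-injective eq)

below-line : ∀ {n} (F : Subset n) u → ¬ Hits F (u + 1) → ∀ j → j ≤ n → 2 * cntPrefix F j ≤ j + u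
below-line F u F↛ zero _ rewrite cntPrefix-zero F = z≤n
below-line F u F↛ (suc j) j<n = ≤-pred (≤∧≢⇒< one-step-up off-line)
  where
  one-step-up : 2 * cntPrefix F (suc j) ≤ 2 + (j + u)
  one-step-up = begin
    2 * cntPrefix F (suc j)   ≤⟨ *-monoʳ-≤ 2 (cntPrefix-suc≤ F j) ⟩
    2 * suc (cntPrefix F j)   ≡⟨ *-suc 2 (cntPrefix F j) ⟩
    2 + 2 * cntPrefix F j     ≤⟨ +-monoʳ-≤ 2 (below-line F u F↛ j (<⇒≤ j<n)) ⟩
    2 + (j + u)               ∎
    where open ≤-Reasoning
  off-line : 2 * cntPrefix F (suc j) ≢ 2 + (j + u)
  off-line e = F↛ (suc j , j<n , trans e (cong suc (sym (trans (cong (λ m → j + m) (+-comm u 1)) (+-suc j u)))))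

HitsAt⇒offset : ∀ {n} (F : Subset n) u b → HitsAt F u b → ∃ λ s → b ≡ u + 2 * s
HitsAt⇒offset F u b (_ , 2c≡b+u) = c ∸ u , +-cancelʳ-≡ u b (u + 2 * (c ∸ u)) (begin
    b + u                     ≡⟨ 2c≡b+u ⟨
    2 * c                     ≡⟨ cong (2 *_) (m+[n∸m]≡n u≤c) ⟨
    2 * (u + (c ∸ u))         ≡⟨ u+2s+u≡2[u+s] u (c ∸ u) ⟨
    u + 2 * (c ∸ u) + u       ∎)
  where
  open ≡-Reasoning
  c : ℕ
  c = cntPrefix F b
  double : ∀ m → 2 * m ≡ m + m
  double = solve-∀
  u≤c : u ≤ c
  u≤c = +-cancelˡ-≤ c u c (subst (c + u ≤_) (trans (sym 2c≡b+u) (double c)) (+-monoˡ-≤ u (cntPrefix≤ F b)))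

HitsAt⇒Fsu : ∀ {n} (F : Subset n) u s → HitsAt F u (u + 2 * s) → Fsu s u F
HitsAt⇒Fsu F u s (j≤n , on-line) = j≤n , ≤-reflexive (sym (*-cancelˡ-≡ _ _ 2 (trans on-line (u+2s+u≡2[u+s] u s))))

Fsu⇒HitsAt : ∀ {n} (F : Subset n) u s → ¬ Hits F (u + 1) → Fsu s u F → HitsAt F u (u + 2 * s)
Fsu⇒HitsAt F u s F↛ (j≤n , u+s≤c) =
  j≤n , ≤-antisym (below-line F u F↛ _ j≤n)
                  (subst (_≤ 2 * cntPrefix F (u + 2 * s)) (sym (u+2s+u≡2[u+s] u s)) (*-monoʳ-≤ 2 u+s≤c))

Fsu-unique : ∀ {n} (F : Subset n) u {r s} → FUhat u F → Fsu r u F → Fsu s u F → r ≡ s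
Fsu-unique F u {r} {s} (_ , (_ , _ , only) , F↛) Fr Fs =
  *-cancelˡ-≡ r s 2 (+-cancelˡ-≡ u _ _ (trans (only _ (Fsu⇒HitsAt F u r F↛ Fr)) (sym (only _ (Fsu⇒HitsAt F u s F↛ Fs)))))

no-common-hit⇒Sparse : ∀ {n t u v} (A B : Subset n) → u + v ≡ 2 * t → ¬ Hits A (u + 1) → ¬ Hits B (v + 1) →
  (∀ j → HitsAt A u j → HitsAt B v j → ⊥) → Sparse t A B
no-common-hit⇒Sparse {t = t} {u} {v} A B u+v≡2t A↛ B↛ no-common j j≤n =
  halves-sum< (cntPrefix A j) (cntPrefix B j) (below-line A u A↛ j j≤n) (below-line B v B↛ j j≤n) lines-average
    (λ A-on B-on → no-common j (j≤n , A-on) (j≤n , B-on))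
  where
  rearrange : ∀ j u v → (j + u) + (j + v) ≡ 2 * j + (u + v)
  rearrange = solve-∀
  lines-average : (j + u) + (j + v) ≡ 2 * (j + t)
  lines-average = trans (rearrange j u v) (trans (cong (λ m → 2 * j + m) u+v≡2t) (sym (*-distribˡ-+ 2 j t)))

on-line-at-lone-hit : ∀ {n t u v} {𝒜 ℬ : Family n} → Shifted 𝒜 → CrossIntersecting t 𝒜 ℬ → u + v ≡ 2 * t →
  ∀ {A B b} → 𝒜 A → ¬ Hits A (u + 1) → ℬ B → ¬ Hits B (v + 1) →
  HitsAt B v b → (∀ j → HitsAt B v j → j ≡ b) → HitsAt A u b
on-line-at-lone-hit {u = u} sh cross u+v≡2t {A} {B} {b} A∈𝒜 A↛ B∈ℬ B↛ (b≤n , _) only-b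
  with 2 * cntPrefix A b ≟ b + u
... | yes A-on = b≤n , A-on
... | no A-off = ⊥-elim (Shifted⇒¬Sparse sh (λ A' A'∈𝒜 → cross A' B A'∈𝒜 B∈ℬ) A∈𝒜
        (no-common-hit⇒Sparse A B u+v≡2t A↛ B↛ λ j (_ , A-on) B-hit →
          A-off (subst (λ i → 2 * cntPrefix A i ≡ i + u) (only-b j B-hit) A-on)))

avoids-next-line : ∀ {n} (F : Subset n) u → FUhat u F ⊎ FUhathat u F → ¬ Hits F (u + 1)
avoids-next-line F u (inj₁ (_ , _ , F↛)) = F↛
avoids-next-line F u (inj₂ (_ , _ , F↛)) = F↛

CrossIntersecting-sym : ∀ {n t} {𝒜 ℬ : Family n} → CrossIntersecting t 𝒜 ℬ → CrossIntersecting t ℬ 𝒜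
CrossIntersecting-sym {t = t} cross B A B∈ℬ A∈𝒜 = subst (t ≤_) (cong ∣_∣ (∩-comm A B)) (cross A B A∈𝒜 B∈ℬ)

on-line-at⇒⊆Fsu : ∀ {n u s} {𝒜 : Family n} → (∀ {A} → 𝒜 A → ¬ Hits A (u + 1) → HitsAt A u (u + 2 * s)) →
  ∀ A → 𝒜 A → FUhat u A ⊎ FUhathat u A → Fsu s u A
on-line-at⇒⊆Fsu {u = u} {s} on-line A A∈𝒜 Â = HitsAt⇒Fsu A u s (on-line A∈𝒜 (avoids-next-line A u Â))

lemma3p2 : (n t : ℕ) → 14 ≤ t → (p : ℚ) → 0ℚ <ℚ p → p ≤ℚ (+ 1) /ℚ (suc t) →
    (𝒜 ℬ : Family n) → Shifted 𝒜 → Shifted ℬ → InclusionMaximal 𝒜 → InclusionMaximal ℬ →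
    CrossIntersecting t 𝒜 ℬ → (u v : ℕ) → IsLambda 𝒜 u → IsLambda ℬ v → u + v ≡ 2 * t → u ≤ v →
    (∃ λ A → 𝒜 A × FUhat u A) → (∃ λ B → ℬ B × FUhat v B) →
    Σ ℕ λ s → Σ ℕ λ s' →
    (s ≡ s' + (v ∸ u) / 2
    × (∀ A → 𝒜 A → FUhat u A ⊎ FUhathat u A → Fsu s u A)
    × (∀ B → ℬ B → FUhat v B ⊎ FUhathat v B → Fsu s' v B))
    × (∀ r r' → r ≡ r' + (v ∸ u) / 2
    → (∀ A → 𝒜 A → FUhat u A ⊎ FUhathat u A → Fsu r u A)
    → (∀ B → ℬ B → FUhat v B ⊎ FUhathat v B → Fsu r' v B)
    → r ≡ s × r' ≡ s')
lemma3p2 _ _ _ _ _ _ 𝒜 ℬ sh𝒜 shℬ _ _ cross u v _ _ u+v≡2t u≤v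
  (A₀ , A₀∈𝒜 , Â₀@(_ , (a , A₀-at-a , A₀-only-a) , A₀↛)) (B₀ , B₀∈ℬ , B̂₀@(_ , (b , B₀-at-b , B₀-only-b) , B₀↛)) =
  s , s' , (offset-difference u≤v (trans (sym b≡u+2s) b≡v+2s') , 𝒜⊆Fsu , ℬ⊆Fsu) ,
  λ r r' _ 𝒜⊆Fsu-r ℬ⊆Fsu-r' →
    Fsu-unique A₀ u Â₀ (𝒜⊆Fsu-r A₀ A₀∈𝒜 (inj₁ Â₀)) (𝒜⊆Fsu A₀ A₀∈𝒜 (inj₁ Â₀)) ,
    Fsu-unique B₀ v B̂₀ (ℬ⊆Fsu-r' B₀ B₀∈ℬ (inj₁ B̂₀)) (ℬ⊆Fsu B₀ B₀∈ℬ (inj₁ B̂₀))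
  where
  𝒜-at-b : ∀ {A} → 𝒜 A → ¬ Hits A (u + 1) → HitsAt A u b
  𝒜-at-b A∈𝒜 A↛ = on-line-at-lone-hit sh𝒜 cross u+v≡2t A∈𝒜 A↛ B₀∈ℬ B₀↛ B₀-at-b B₀-only-b
  ℬ-at-a : ∀ {B} → ℬ B → ¬ Hits B (v + 1) → HitsAt B v a
  ℬ-at-a B∈ℬ B↛ = on-line-at-lone-hit shℬ (CrossIntersecting-sym cross) (trans (+-comm v u) u+v≡2t)
                    B∈ℬ B↛ A₀∈𝒜 A₀↛ A₀-at-a A₀-only-a
  a≡b : a ≡ b
  a≡b = sym (A₀-only-a b (𝒜-at-b A₀∈𝒜 A₀↛))
  s s' : ℕ
  s = proj₁ (HitsAt⇒offset A₀ u b (𝒜-at-b A₀∈𝒜 A₀↛))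
  s' = proj₁ (HitsAt⇒offset B₀ v b B₀-at-b)
  b≡u+2s : b ≡ u + 2 * s
  b≡u+2s = proj₂ (HitsAt⇒offset A₀ u b (𝒜-at-b A₀∈𝒜 A₀↛))
  b≡v+2s' : b ≡ v + 2 * s'
  b≡v+2s' = proj₂ (HitsAt⇒offset B₀ v b B₀-at-b)
  𝒜⊆Fsu : ∀ A → 𝒜 A → FUhat u A ⊎ FUhathat u A → Fsu s u A
  𝒜⊆Fsu = on-line-at⇒⊆Fsu λ {A} A∈𝒜 A↛ → subst (HitsAt A u) b≡u+2s (𝒜-at-b A∈𝒜 A↛)
  ℬ⊆Fsu : ∀ B → ℬ B → FUhat v B ⊎ FUhathat v B → Fsu s' v B
  ℬ⊆Fsu = on-line-at⇒⊆Fsu λ {B} B∈ℬ B↛ → subst (HitsAt B v) (trans a≡b b≡v+2s') (ℬ-at-a B∈ℬ B↛)
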